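{- In a dagger category $(\mathbb{X},\dagger)$ with Moore-Penrose square roots, a map $f$ is Moore-Penrose invertible if and only if $f$ has a Moore-Penrose polar decomposition.
   Context: Composition is in diagrammatic order. A dagger category is a category with an identity-on-objects contravariant involutive functor $\dagger$. A partial isometry is $q$ with $qq^\dagger q = q$; $p: A\to A$ is positive if $p = gg^\dagger$ for some $g: A\to X$. A Moore-Penrose inverse of $f: A\to B$ is $f^\circ: B\to A$ with $ff^\circ f = f$, $f^\circ f f^\circ = f^\circ$, $(ff^\circ)^\dagger = ff^\circ$, $(f^\circ f)^\dagger = f^\circ f$. A Moore-Penrose invertible positive map $p$ has a Moore-Penrose square root if there is a Moore-Penrose invertible positive map $\sqrt{p}$ with $\sqrt{p}\sqrt{p} = p$; the dagger category has Moore-Penrose square roots if every Moore-Penrose invertible positive map has one. A Moore-Penrose polar decomposition of $f: A\to B$ is a pair $(u: A\to B, h: B\to B)$ with $u$ a partial isometry, $h$ positive and Moore-Penrose invertible, $f = uh$, and $u^\dagger u = hh^\circ$. -}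

module Defs where

open import Level using (Level; _⊔_; suc)
open import Data.Product using (Σ; Σ-syntax; _×_; _,_)
open import Relation.Binary using (Rel; IsEquivalence)

-- A category with setoid-valued hom-sets; composition in DIAGRAMMATIC order:
-- f ⨾ g  means "first f, then g".
record Category (o ℓ e : Level) : Set (suc (o ⊔ ℓ ⊔ e)) where
  infixr 9 _⨾_
  infix  4 _≈_
  field
    Obj   : Set o
    Hom   : Obj → Obj → Set ℓ
    _≈_   : ∀ {A B} → Rel (Hom A B) e
    id    : ∀ {A} → Hom A A
    _⨾_   : ∀ {A B C} → Hom A B → Hom B C → Hom A C
    ≈-equiv  : ∀ {A B} → IsEquivalence (_≈_ {A} {B})
    ⨾-cong   : ∀ {A B C} {f f' : Hom A B} {g g' : Hom B C} →
               f ≈ f' → g ≈ g' → f ⨾ g ≈ f' ⨾ g'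
    assoc    : ∀ {A B C D} {f : Hom A B} {g : Hom B C} {h : Hom C D} →
               (f ⨾ g) ⨾ h ≈ f ⨾ (g ⨾ h)
    identityˡ : ∀ {A B} {f : Hom A B} → id ⨾ f ≈ f
    identityʳ : ∀ {A B} {f : Hom A B} → f ⨾ id ≈ f

record DaggerCategory (o ℓ e : Level) : Set (suc (o ⊔ ℓ ⊔ e)) where
  field
    category : Category o ℓ e
  open Category category public
  infix 10 _†
  field
    _†       : ∀ {A B} → Hom A B → Hom B A
    †-cong   : ∀ {A B} {f g : Hom A B} → f ≈ g → f † ≈ g †
    †-id     : ∀ {A} → (id {A}) † ≈ id
    †-⨾      : ∀ {A B C} {f : Hom A B} {g : Hom B C} → (f ⨾ g) † ≈ g † ⨾ f †
    †-invol  : ∀ {A B} {f : Hom A B} → (f †) † ≈ f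

module DaggerNotions {o ℓ e : Level} (𝕏 : DaggerCategory o ℓ e) where
  open DaggerCategory 𝕏

  IsPartialIsometry : ∀ {A B} → Hom A B → Set e
  IsPartialIsometry q = q ⨾ q † ⨾ q ≈ q

  IsPositive : ∀ {A} → Hom A A → Set (o ⊔ ℓ ⊔ e)
  IsPositive {A} p = Σ[ X ∈ Obj ] Σ[ g ∈ Hom A X ] (p ≈ g ⨾ g †)

  IsMPInverse : ∀ {A B} → Hom A B → Hom B A → Set e
  IsMPInverse f f° =
    (f ⨾ f° ⨾ f ≈ f) × (f° ⨾ f ⨾ f° ≈ f°) ×
    ((f ⨾ f°) † ≈ f ⨾ f°) × ((f° ⨾ f) † ≈ f° ⨾ f)

  MPInvertible : ∀ {A B} → Hom A B → Set (ℓ ⊔ e)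
  MPInvertible {A} {B} f = Σ[ f° ∈ Hom B A ] IsMPInverse f f°

  HasMPSquareRoot : ∀ {A} → Hom A A → Set (o ⊔ ℓ ⊔ e)
  HasMPSquareRoot {A} p =
    Σ[ s ∈ Hom A A ] (IsPositive s × MPInvertible s × (s ⨾ s ≈ p))

  HasMPSquareRoots : Set (o ⊔ ℓ ⊔ e)
  HasMPSquareRoots = ∀ {A} (p : Hom A A) →
    IsPositive p → MPInvertible p → HasMPSquareRoot p

  -- The equation u† u = h h° refers to the Moore-Penrose inverse h° of h
  -- (unique when it exists), so we carry it as a witness.
  IsMPPolarDecomposition : ∀ {A B} → Hom A B → Hom A B → Hom B B →
                           Set (o ⊔ ℓ ⊔ e)
  IsMPPolarDecomposition f u h =
    IsPartialIsometry u × IsPositive h × (f ≈ u ⨾ h) ×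
    (Σ[ h° ∈ _ ] (IsMPInverse h h° × (u † ⨾ u ≈ h ⨾ h°)))

  HasMPPolarDecomposition : ∀ {A B} → Hom A B → Set (o ⊔ ℓ ⊔ e)
  HasMPPolarDecomposition {A} {B} f =
    Σ[ u ∈ Hom A B ] Σ[ h ∈ Hom B B ] IsMPPolarDecomposition f u h

{-# OPTIONS --safe #-}
-- For f with Moore-Penrose inverse f°, the positive map f† f is Moore-Penrose
-- invertible with inverse f° f°†, so it has a Moore-Penrose square root h; then
-- u = f h° is a partial isometry with f = u h and u† u = h h°. Conversely, for a
-- polar decomposition f = u h the map h° u† is a Moore-Penrose inverse of f,
-- because u† u = h h° lets the partial isometry u cancel against u† around h.
module Submission where

open import Defs
open import Level using (Level)
open import Data.Product using (_×_; _,_; proj₁; proj₂)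
open import Relation.Binary using (Setoid; IsEquivalence)
import Relation.Binary.Reasoning.Setoid as SetoidReasoning

module _ {o ℓ e : Level} (𝕏 : DaggerCategory o ℓ e) where
  open DaggerCategory 𝕏
  open DaggerNotions 𝕏

  hom-setoid : Obj → Obj → Setoid ℓ e
  hom-setoid A B = record { isEquivalence = ≈-equiv {A} {B} }

  private
    module ≈ {A B : Obj} = IsEquivalence (≈-equiv {A} {B})
    module HomReasoning {A B : Obj} = SetoidReasoning (hom-setoid A B)
    open HomReasoning

  ⨾-congˡ : ∀ {A B C} {f : Hom A B} {g h : Hom B C} → g ≈ h → f ⨾ g ≈ f ⨾ h
  ⨾-congˡ = ⨾-cong ≈.refl

  ⨾-congʳ : ∀ {A B C} {f g : Hom A B} {h : Hom B C} → f ≈ g → f ⨾ h ≈ g ⨾ h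
  ⨾-congʳ p = ⨾-cong p ≈.refl

  pullˡ : ∀ {A B C D} {a : Hom A B} {b : Hom B C} {c : Hom A C} {r : Hom C D} →
          a ⨾ b ≈ c → a ⨾ b ⨾ r ≈ c ⨾ r
  pullˡ p = ≈.trans (≈.sym assoc) (⨾-congʳ p)

  pullˡ₃ : ∀ {A B C D E} {a : Hom A B} {b : Hom B C} {c : Hom C D} {w : Hom A D}
           {r : Hom D E} → a ⨾ b ⨾ c ≈ w → a ⨾ b ⨾ c ⨾ r ≈ w ⨾ r
  pullˡ₃ p = ≈.trans (⨾-congˡ (≈.sym assoc)) (pullˡ p)

  IsSelfAdjoint : ∀ {A} → Hom A A → Set e
  IsSelfAdjoint p = p † ≈ p

  selfAdjoint-resp-≈ : ∀ {A} {p q : Hom A A} → p ≈ q → IsSelfAdjoint q → IsSelfAdjoint p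
  selfAdjoint-resp-≈ p≈q q† = ≈.trans (†-cong p≈q) (≈.trans q† (≈.sym p≈q))

  ⨾†-selfAdjoint : ∀ {A B} (g : Hom A B) → IsSelfAdjoint (g ⨾ g †)
  ⨾†-selfAdjoint g = ≈.trans †-⨾ (⨾-congʳ †-invol)

  positive⇒selfAdjoint : ∀ {A} {p : Hom A A} → IsPositive p → IsSelfAdjoint p
  positive⇒selfAdjoint (_ , g , p≈gg†) = selfAdjoint-resp-≈ p≈gg† (⨾†-selfAdjoint g)

  †⨾-positive : ∀ {A B} (f : Hom A B) → IsPositive (f † ⨾ f)
  †⨾-positive {A} f = A , f † , ⨾-congˡ (≈.sym †-invol)

  MPInverse-resp-≈ : ∀ {A B} {f g : Hom A B} {g° : Hom B A} →
                     f ≈ g → IsMPInverse g g° → IsMPInverse f g°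
  MPInverse-resp-≈ f≈g (g⨾g°⨾g≈g , g°⨾g⨾g°≈g° , g⨾g°-sa , g°⨾g-sa) =
    ≈.trans (⨾-cong f≈g (⨾-congˡ f≈g)) (≈.trans g⨾g°⨾g≈g (≈.sym f≈g)) ,
    ≈.trans (⨾-congˡ (⨾-congʳ f≈g)) g°⨾g⨾g°≈g° ,
    selfAdjoint-resp-≈ (⨾-congʳ f≈g) g⨾g°-sa ,
    selfAdjoint-resp-≈ (⨾-congˡ f≈g) g°⨾g-sa

  MPInverse-absorbʳ : ∀ {A B} {h h° : Hom B B} {f g : Hom A B} →
                      IsMPInverse h h° → f ≈ g ⨾ h → f ⨾ h° ⨾ h ≈ f
  MPInverse-absorbʳ (h⨾h°⨾h≈h , _) f≈gh =
    ≈.trans (⨾-congʳ f≈gh)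
      (≈.trans assoc (≈.trans (⨾-congˡ h⨾h°⨾h≈h) (≈.sym f≈gh)))

  module MPInverse {A B} {f : Hom A B} {f° : Hom B A} (mp : IsMPInverse f f°) where
    private
      f⨾f°⨾f≈f : f ⨾ f° ⨾ f ≈ f
      f⨾f°⨾f≈f = proj₁ mp

      f°⨾f⨾f°≈f° : f° ⨾ f ⨾ f° ≈ f°
      f°⨾f⨾f°≈f° = proj₁ (proj₂ mp)

      f⨾f°-sa : IsSelfAdjoint (f ⨾ f°)
      f⨾f°-sa = proj₁ (proj₂ (proj₂ mp))

      f°⨾f-sa : IsSelfAdjoint (f° ⨾ f)
      f°⨾f-sa = proj₂ (proj₂ (proj₂ mp))

    f°†⨾f†≈f⨾f° : f° † ⨾ f † ≈ f ⨾ f°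
    f°†⨾f†≈f⨾f° = ≈.trans (≈.sym †-⨾) f⨾f°-sa

    f†⨾f°†≈f°⨾f : f † ⨾ f° † ≈ f° ⨾ f
    f†⨾f°†≈f°⨾f = ≈.trans (≈.sym †-⨾) f°⨾f-sa

    f†⨾f⨾f°≈f† : f † ⨾ f ⨾ f° ≈ f †
    f†⨾f⨾f°≈f† = begin
      f † ⨾ f ⨾ f°        ≈⟨ ⨾-congˡ f⨾f°-sa ⟨
      f † ⨾ (f ⨾ f°) †    ≈⟨ †-⨾ ⟨
      ((f ⨾ f°) ⨾ f) †    ≈⟨ †-cong (≈.trans assoc f⨾f°⨾f≈f) ⟩
      f †                 ∎

    f°⨾f⨾f†≈f† : f° ⨾ f ⨾ f † ≈ f †
    f°⨾f⨾f†≈f† = begin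
      f° ⨾ f ⨾ f †        ≈⟨ assoc ⟨
      (f° ⨾ f) ⨾ f †      ≈⟨ ⨾-congʳ f°⨾f-sa ⟨
      (f° ⨾ f) † ⨾ f †    ≈⟨ †-⨾ ⟨
      (f ⨾ f° ⨾ f) †      ≈⟨ †-cong f⨾f°⨾f≈f ⟩
      f †                 ∎

    f≈f°†⨾f†⨾f : f ≈ f° † ⨾ f † ⨾ f
    f≈f°†⨾f†⨾f = begin
      f                   ≈⟨ f⨾f°⨾f≈f ⟨
      f ⨾ f° ⨾ f          ≈⟨ assoc ⟨
      (f ⨾ f°) ⨾ f        ≈⟨ pullˡ f°†⨾f†≈f⨾f° ⟨
      f° † ⨾ f † ⨾ f      ∎

    †⨾-MPInverse : IsMPInverse (f † ⨾ f) (f° ⨾ f° †)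
    †⨾-MPInverse =
      ≈.trans (≈.sym assoc) (≈.trans (⨾-congʳ f†f⨾f°f°†≈f°⨾f)
        (≈.trans assoc (pullˡ₃ f°⨾f⨾f†≈f†))) ,
      ≈.trans (≈.sym assoc) (≈.trans (⨾-congʳ f°f°†⨾f†f≈f°⨾f)
        (≈.trans assoc (pullˡ₃ f°⨾f⨾f°≈f°))) ,
      selfAdjoint-resp-≈ f†f⨾f°f°†≈f°⨾f f°⨾f-sa ,
      selfAdjoint-resp-≈ f°f°†⨾f†f≈f°⨾f f°⨾f-sa
      where
      f†f⨾f°f°†≈f°⨾f : (f † ⨾ f) ⨾ (f° ⨾ f° †) ≈ f° ⨾ f
      f†f⨾f°f°†≈f°⨾f = begin
        (f † ⨾ f) ⨾ (f° ⨾ f° †)   ≈⟨ assoc ⟩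
        f † ⨾ f ⨾ f° ⨾ f° †       ≈⟨ pullˡ₃ f†⨾f⨾f°≈f† ⟩
        f † ⨾ f° †                ≈⟨ f†⨾f°†≈f°⨾f ⟩
        f° ⨾ f                    ∎

      f°f°†⨾f†f≈f°⨾f : (f° ⨾ f° †) ⨾ (f † ⨾ f) ≈ f° ⨾ f
      f°f°†⨾f†f≈f°⨾f = begin
        (f° ⨾ f° †) ⨾ (f † ⨾ f)   ≈⟨ assoc ⟩
        f° ⨾ f° † ⨾ f † ⨾ f       ≈⟨ ⨾-congˡ (pullˡ f°†⨾f†≈f⨾f°) ⟩
        f° ⨾ (f ⨾ f°) ⨾ f         ≈⟨ ⨾-congˡ assoc ⟩
        f° ⨾ f ⨾ f° ⨾ f           ≈⟨ pullˡ₃ f°⨾f⨾f°≈f° ⟩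
        f° ⨾ f                    ∎

  selfAdjoint-MPInverse-comm : ∀ {A} {h h° : Hom A A} → IsSelfAdjoint h →
                               IsMPInverse h h° → h° † ⨾ h ≈ h ⨾ h°
  selfAdjoint-MPInverse-comm h-sa (_ , _ , h⨾h°-sa , _) =
    ≈.trans (⨾-congˡ (≈.sym h-sa)) (≈.trans (≈.sym †-⨾) h⨾h°-sa)

  polarDecomposition-of-root :
    ∀ {A B} {f : Hom A B} {f° : Hom B A} {h h° : Hom B B} →
    IsMPInverse f f° → IsPositive h → IsMPInverse h h° → h ⨾ h ≈ f † ⨾ f →
    IsMPPolarDecomposition f (f ⨾ h°) h
  polarDecomposition-of-root {f = f} {f°} {h} {h°} f-mp h-pos h-mp h⨾h≈f†⨾f =
    u-partialIsometry , h-pos , ≈.sym (≈.trans assoc f⨾h°⨾h≈f) ,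
    h° , h-mp , u†⨾u≈h⨾h°
    where
    open MPInverse f-mp using (f≈f°†⨾f†⨾f)

    h⨾h°⨾h≈h : h ⨾ h° ⨾ h ≈ h
    h⨾h°⨾h≈h = proj₁ h-mp

    h°⨾h⨾h°≈h° : h° ⨾ h ⨾ h° ≈ h°
    h°⨾h⨾h°≈h° = proj₁ (proj₂ h-mp)

    f⨾h°⨾h≈f : f ⨾ h° ⨾ h ≈ f
    f⨾h°⨾h≈f = MPInverse-absorbʳ h-mp
      (≈.trans f≈f°†⨾f†⨾f (≈.trans (⨾-congˡ (≈.sym h⨾h≈f†⨾f)) (≈.sym assoc)))

    h°†⨾h≈h⨾h° : h° † ⨾ h ≈ h ⨾ h°
    h°†⨾h≈h⨾h° = selfAdjoint-MPInverse-comm (positive⇒selfAdjoint h-pos) h-mp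

    u†⨾u≈h⨾h° : (f ⨾ h°) † ⨾ (f ⨾ h°) ≈ h ⨾ h°
    u†⨾u≈h⨾h° = begin
      (f ⨾ h°) † ⨾ (f ⨾ h°)     ≈⟨ ⨾-congʳ †-⨾ ⟩
      (h° † ⨾ f †) ⨾ (f ⨾ h°)   ≈⟨ assoc ⟩
      h° † ⨾ f † ⨾ f ⨾ h°       ≈⟨ ⨾-congˡ (≈.trans (⨾-congʳ h⨾h≈f†⨾f) assoc) ⟨
      h° † ⨾ (h ⨾ h) ⨾ h°       ≈⟨ ⨾-congˡ assoc ⟩
      h° † ⨾ h ⨾ h ⨾ h°         ≈⟨ pullˡ h°†⨾h≈h⨾h° ⟩
      (h ⨾ h°) ⨾ h ⨾ h°         ≈⟨ assoc ⟩
      h ⨾ h° ⨾ h ⨾ h°           ≈⟨ pullˡ₃ h⨾h°⨾h≈h ⟩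
      h ⨾ h°                    ∎

    u-partialIsometry : IsPartialIsometry (f ⨾ h°)
    u-partialIsometry = begin
      (f ⨾ h°) ⨾ (f ⨾ h°) † ⨾ (f ⨾ h°)   ≈⟨ ⨾-congˡ u†⨾u≈h⨾h° ⟩
      (f ⨾ h°) ⨾ h ⨾ h°                  ≈⟨ assoc ⟩
      f ⨾ h° ⨾ h ⨾ h°                    ≈⟨ ⨾-congˡ h°⨾h⨾h°≈h° ⟩
      f ⨾ h°                             ∎

  polarDecomposition-MPInverse :
    ∀ {A B} {u : Hom A B} {h h° : Hom B B} →
    IsPartialIsometry u → IsMPInverse h h° → u † ⨾ u ≈ h ⨾ h° →
    IsMPInverse (u ⨾ h) (h° ⨾ u †)
  polarDecomposition-MPInverse {u = u} {h} {h°}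
      u⨾u†⨾u≈u (h⨾h°⨾h≈h , h°⨾h⨾h°≈h° , _ , h°⨾h-sa) u†⨾u≈h⨾h° =
    ≈.trans (⨾-congˡ h°u†⨾uh≈h°⨾h) (≈.trans assoc (⨾-congˡ h⨾h°⨾h≈h)) ,
    ≈.trans (≈.sym assoc)
      (≈.trans (⨾-congʳ h°u†⨾uh≈h°⨾h) (≈.trans assoc (pullˡ₃ h°⨾h⨾h°≈h°))) ,
    selfAdjoint-resp-≈ uh⨾h°u†≈u⨾u† (⨾†-selfAdjoint u) ,
    selfAdjoint-resp-≈ h°u†⨾uh≈h°⨾h h°⨾h-sa
    where
    u†⨾u⨾h≈h : u † ⨾ u ⨾ h ≈ h
    u†⨾u⨾h≈h = ≈.trans (pullˡ u†⨾u≈h⨾h°) (≈.trans assoc h⨾h°⨾h≈h)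

    h°u†⨾uh≈h°⨾h : (h° ⨾ u †) ⨾ (u ⨾ h) ≈ h° ⨾ h
    h°u†⨾uh≈h°⨾h = ≈.trans assoc (⨾-congˡ u†⨾u⨾h≈h)

    uh⨾h°u†≈u⨾u† : (u ⨾ h) ⨾ (h° ⨾ u †) ≈ u ⨾ u †
    uh⨾h°u†≈u⨾u† = begin
      (u ⨾ h) ⨾ (h° ⨾ u †)   ≈⟨ assoc ⟩
      u ⨾ h ⨾ h° ⨾ u †       ≈⟨ ⨾-congˡ (≈.trans (⨾-congʳ u†⨾u≈h⨾h°) assoc) ⟨
      u ⨾ (u † ⨾ u) ⨾ u †    ≈⟨ ⨾-congˡ assoc ⟩
      u ⨾ u † ⨾ u ⨾ u †      ≈⟨ pullˡ₃ u⨾u†⨾u≈u ⟩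
      u ⨾ u †                ∎

  MPInvertible⇒HasMPPolarDecomposition :
    HasMPSquareRoots → ∀ {A B} {f : Hom A B} → MPInvertible f → HasMPPolarDecomposition f
  MPInvertible⇒HasMPPolarDecomposition roots {f = f} (f° , f-mp)
    with roots (f † ⨾ f) (†⨾-positive f) (f° ⨾ f° † , MPInverse.†⨾-MPInverse f-mp)
  ... | h , h-pos , (h° , h-mp) , h⨾h≈f†⨾f =
    f ⨾ h° , h , polarDecomposition-of-root f-mp h-pos h-mp h⨾h≈f†⨾f

  HasMPPolarDecomposition⇒MPInvertible :
    ∀ {A B} {f : Hom A B} → HasMPPolarDecomposition f → MPInvertible f
  HasMPPolarDecomposition⇒MPInvertible
      (u , h , u-pi , _ , f≈u⨾h , h° , h-mp , u†⨾u≈h⨾h°) =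
    h° ⨾ u † ,
    MPInverse-resp-≈ f≈u⨾h (polarDecomposition-MPInverse u-pi h-mp u†⨾u≈h⨾h°)

mainTheorem17 : {o ℓ e : Level} (𝕏 : DaggerCategory o ℓ e) →
    DaggerNotions.HasMPSquareRoots 𝕏 →
    ∀ {A B} (f : DaggerCategory.Hom 𝕏 A B) →
    (DaggerNotions.MPInvertible 𝕏 f → DaggerNotions.HasMPPolarDecomposition 𝕏 f) ×
    (DaggerNotions.HasMPPolarDecomposition 𝕏 f → DaggerNotions.MPInvertible 𝕏 f)
mainTheorem17 𝕏 roots f =
  MPInvertible⇒HasMPPolarDecomposition 𝕏 roots ,
  HasMPPolarDecomposition⇒MPInvertible 𝕏
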